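{- There is no function $\alpha:\mathbb{N}\rightarrow\mathbb{N}$ such that every finite metric space can be embedded into $\ell_\infty$ with prioritized dimension $\alpha$ and distortion $t$, for any fixed $t<\frac{3}{2}$.
   Context: An embedding $f:X\to\ell_\infty$ of a metric space $(X,d)$ has distortion $t\ge1$ if $d(x,y)\le\|f(x)-f(y)\|_\infty\le t\cdot d(x,y)$ for all $x,y\in X$. Given a priority ordering $X=\{x_1,\dots,x_n\}$, the embedding $f$ has prioritized dimension $\alpha:\mathbb{N}\to\mathbb{N}$ if $f(x_j)$ is non-zero only in its first $\alpha(j)$ coordinates, i.e. $f_i(x_j)=0$ whenever $i>\alpha(j)$. The function $\alpha$ must work for every finite metric space and every priority ordering; it may not depend on $n=|X|$.
   Formalization: The distortion t ranges over the rationals, and the distances of the finite metric spaces and the coordinates of the embeddings into $\ell_\infty$ take values in ℚ. -}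

module Defs where

open import Data.Nat using (ℕ; suc; _<_)
open import Data.Fin using (Fin; toℕ)
open import Data.Integer using (+_)
open import Data.Rational using (ℚ; 0ℚ; _/_; _≤_; _-_; _*_; ∣_∣)
open import Data.Product using (Σ; _×_; ∃)
open import Relation.Binary.PropositionalEquality using (_≡_)

three-halves : ℚ
three-halves = + 3 / 2

record IsMetric {n : ℕ} (d : Fin n → Fin n → ℚ) : Set where
  field
    nonneg    : ∀ x y → 0ℚ ≤ d x y
    zero⇔eq   : ∀ x y → (d x y ≡ 0ℚ → x ≡ y) × (x ≡ y → d x y ≡ 0ℚ)
    symmetric : ∀ x y → d x y ≡ d y x
    triangle  : ∀ x y z → d x z ≤ d x y Data.Rational.+ d y z

-- Points of ℓ∞ used: sequences ℕ → ℚ (coordinate i is index i, starting at 0).  Since all images are finitely supported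
-- (prioritized dimension), the sup-norm is a max over finitely many coordinates:
--   ‖f x - f y‖∞ ≤ t·d  ⇔ every coordinate difference ≤ t·d,
--   d ≤ ‖f x - f y‖∞    ⇔ some coordinate difference ≥ d.
HasDistortion : {n : ℕ} → (Fin n → Fin n → ℚ) → (Fin n → ℕ → ℚ) → ℚ → Set
HasDistortion d f t =
  ∀ x y → (∀ i → ∣ f x i - f y i ∣ ≤ t * d x y)
        × (∃ λ i → d x y ≤ ∣ f x i - f y i ∣)

-- Priority ordering x_1,…,x_n given by x_j = the element of Fin n with toℕ = j - 1.
-- f(x_j) is non-zero only in its first α(j) coordinates (coordinates 0..α(j)-1).
PrioritizedDim : {n : ℕ} → (ℕ → ℕ) → (Fin n → ℕ → ℚ) → Set
PrioritizedDim α f = ∀ x i → α (suc (toℕ x)) < suc i → f x i ≡ 0ℚ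

{-# OPTIONS --safe #-}
-- Take two points a, b and m pairs (y j, z j) with d(y j, a) = d(a, b) = d(b, z j) = 1,
-- d(y j, z j) = 3 and all other distances 2. If f(a) and f(b) vanish beyond coordinate K,
-- the coordinate where ∣f(y j) - f(z j)∣ ≥ 3 lies below K: beyond it f(y j) and f(z j) are
-- both within t of 0, and 2t < 3. With m > K pairs, two pairs share such a coordinate i; but
-- reals p, q, p′, q′ with ∣p - q∣, ∣p′ - q′∣ ≥ 3 cannot have all four crosswise differences
-- below 3, and these are at most 2t since the corresponding distances are 2.
module Submission where

open import Defs
open import Data.Nat using (ℕ)
open import Data.Fin using (Fin)
open import Data.Rational using (ℚ; 1ℚ; _≤_; _<_)
open import Data.Product using (Σ; _×_)
open import Relation.Nullary using (¬_)

open import Data.Empty using (⊥; ⊥-elim)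
open import Data.Fin as Fin using (zero; suc; toℕ; fromℕ<; _↑ˡ_; _↑ʳ_; splitAt; _≟_)
open import Data.Fin.Properties using (pigeonhole; toℕ-fromℕ<; <⇒≢; splitAt-↑ˡ; splitAt-↑ʳ)
import Data.Nat as ℕ
import Data.Nat.Properties as ℕ
import Data.Integer as ℤ
open import Data.Rational using (0ℚ; _+_; _-_; _*_; -_; ∣_∣; _/_; _≤?_; _<?_)
open import Data.Rational.Properties hiding (_≟_; <⇒≢)
open import Data.Rational.Solver using (module +-*-Solver)
open import Data.Product using (_,_; proj₁; proj₂; ∃₂)
open import Data.Sum using (_⊎_; inj₁; inj₂; [_,_]′)
open import Relation.Nullary using (Dec; yes; no)
open import Relation.Nullary.Decidable using (from-yes)
open import Function using (_∘_)
open import Relation.Binary.PropositionalEquality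

open import Algebra.Properties.Group +-0-group using (⁻¹-involutive)

p≤∣p∣ : ∀ p → p ≤ ∣ p ∣
p≤∣p∣ p with ∣p∣≡p∨∣p∣≡-p p
... | inj₁ ∣p∣≡p  = ≤-reflexive (sym ∣p∣≡p)
... | inj₂ ∣p∣≡-p = ≤-trans p≤0 (0≤∣p∣ p)
  where
  p≤0 : p ≤ 0ℚ
  p≤0 = subst (_≤ 0ℚ) (⁻¹-involutive p) (neg-antimono-≤ (subst (0ℚ ≤_) ∣p∣≡-p (0≤∣p∣ p)))

-p≤∣p∣ : ∀ p → - p ≤ ∣ p ∣
-p≤∣p∣ p = subst (- p ≤_) (∣-p∣≡∣p∣ p) (p≤∣p∣ (- p))

∣p∣+∣q∣≤∣p+q∣⊎∣p-q∣ : ∀ p q → ∣ p ∣ + ∣ q ∣ ≤ ∣ p + q ∣ ⊎ ∣ p ∣ + ∣ q ∣ ≤ ∣ p - q ∣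
∣p∣+∣q∣≤∣p+q∣⊎∣p-q∣ p q with ∣p∣≡p∨∣p∣≡-p p | ∣p∣≡p∨∣p∣≡-p q
... | inj₁ ∣p∣≡p  | inj₁ ∣q∣≡q  rewrite ∣p∣≡p | ∣q∣≡q = inj₁ (p≤∣p∣ (p + q))
... | inj₂ ∣p∣≡-p | inj₂ ∣q∣≡-q rewrite ∣p∣≡-p | ∣q∣≡-q =
  inj₁ (subst (_≤ ∣ p + q ∣) (neg-distrib-+ p q) (-p≤∣p∣ (p + q)))
... | inj₁ ∣p∣≡p  | inj₂ ∣q∣≡-q rewrite ∣p∣≡p | ∣q∣≡-q = inj₂ (p≤∣p∣ (p - q))
... | inj₂ ∣p∣≡-p | inj₁ ∣q∣≡q  rewrite ∣p∣≡-p | ∣q∣≡q =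
  inj₂ (subst (_≤ ∣ p - q ∣) -[p-q]≡-p+q (-p≤∣p∣ (p - q)))
  where
  -[p-q]≡-p+q : - (p - q) ≡ - p + q
  -[p-q]≡-p+q = trans (neg-distrib-+ p (- q)) (cong (λ r → - p + r) (⁻¹-involutive q))

∣p-q∣≤∣p-r∣+∣r-q∣ : ∀ p q r → ∣ p - q ∣ ≤ ∣ p - r ∣ + ∣ r - q ∣
∣p-q∣≤∣p-r∣+∣r-q∣ p q r =
  subst (λ s → ∣ s ∣ ≤ ∣ p - r ∣ + ∣ r - q ∣) (sym p-q≡[p-r]+[r-q]) (∣p+q∣≤∣p∣+∣q∣ (p - r) (r - q))
  where
  open +-*-Solver
  p-q≡[p-r]+[r-q] : p - q ≡ (p - r) + (r - q)
  p-q≡[p-r]+[r-q] = solve 3 (λ p q r → p :- q := (p :- r) :+ (r :- q)) refl p q r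

-- One of (p - q) ± (p′ - q′) has absolute value at least ∣ p - q ∣ + ∣ p′ - q′ ∣ ≥ 2c, while
-- each regroups as a sum of two crosswise differences.
far-pairs-not-crosswise-close : ∀ {c} p q p′ q′ → c ≤ ∣ p - q ∣ → c ≤ ∣ p′ - q′ ∣ →
  ∣ p - q′ ∣ < c → ∣ p′ - q ∣ < c → ∣ p - p′ ∣ < c → ∣ q - q′ ∣ < c → ⊥
far-pairs-not-crosswise-close {c} p q p′ q′ far far′ pq′ p′q pp′ qq′ =
  <-irrefl refl (≤-<-trans (+-mono-≤ far far′) sum-of-far<2c)
  where
  open +-*-Solver
  open ≤-Reasoning

  sum-of-far<2c : ∣ p - q ∣ + ∣ p′ - q′ ∣ < c + c
  sum-of-far<2c with ∣p∣+∣q∣≤∣p+q∣⊎∣p-q∣ (p - q) (p′ - q′)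
  ... | inj₁ ≤∣sum∣ = begin-strict
    ∣ p - q ∣ + ∣ p′ - q′ ∣    ≤⟨ ≤∣sum∣ ⟩
    ∣ (p - q) + (p′ - q′) ∣    ≡⟨ cong ∣_∣ (solve 4 (λ p q p′ q′ → (p :- q) :+ (p′ :- q′) := (p :- q′) :+ (p′ :- q)) refl p q p′ q′) ⟩
    ∣ (p - q′) + (p′ - q) ∣    ≤⟨ ∣p+q∣≤∣p∣+∣q∣ (p - q′) (p′ - q) ⟩
    ∣ p - q′ ∣ + ∣ p′ - q ∣    <⟨ +-mono-< pq′ p′q ⟩
    c + c                      ∎
  ... | inj₂ ≤∣diff∣ = begin-strict
    ∣ p - q ∣ + ∣ p′ - q′ ∣    ≤⟨ ≤∣diff∣ ⟩
    ∣ (p - q) - (p′ - q′) ∣    ≡⟨ cong ∣_∣ (solve 4 (λ p q p′ q′ → (p :- q) :- (p′ :- q′) := (p :- p′) :- (q :- q′)) refl p q p′ q′) ⟩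
    ∣ (p - p′) - (q - q′) ∣    ≤⟨ ∣p-q∣≤∣p∣+∣q∣ (p - p′) (q - q′) ⟩
    ∣ p - p′ ∣ + ∣ q - q′ ∣    <⟨ +-mono-< pp′ qq′ ⟩
    c + c                      ∎

data Length : Set where
  one two three : Length

⟦_⟧ : Length → ℚ
⟦ one ⟧   = 1ℚ
⟦ two ⟧   = ℤ.+ 2 / 1
⟦ three ⟧ = ℤ.+ 3 / 1

1≤⟦_⟧ : ∀ ℓ → 1ℚ ≤ ⟦ ℓ ⟧
1≤⟦ one ⟧   = ≤-refl
1≤⟦ two ⟧   = from-yes (1ℚ ≤? ⟦ two ⟧)
1≤⟦ three ⟧ = from-yes (1ℚ ≤? ⟦ three ⟧)

0<⟦_⟧ : ∀ ℓ → 0ℚ < ⟦ ℓ ⟧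
0<⟦ ℓ ⟧ = <-≤-trans (from-yes (0ℚ <? 1ℚ)) 1≤⟦ ℓ ⟧

⟦two⟧≤⟦_⟧+⟦_⟧ : ∀ ℓ m → ⟦ two ⟧ ≤ ⟦ ℓ ⟧ + ⟦ m ⟧
⟦two⟧≤⟦ ℓ ⟧+⟦ m ⟧ = +-mono-≤ 1≤⟦ ℓ ⟧ 1≤⟦ m ⟧

⟦⟧-triangle : ∀ k ℓ m → (k ≡ three → ℓ ≡ one → m ≡ one → ⊥) → ⟦ k ⟧ ≤ ⟦ ℓ ⟧ + ⟦ m ⟧
⟦⟧-triangle one   ℓ     m     _       = ≤-trans (from-yes (⟦ one ⟧ ≤? ⟦ two ⟧)) ⟦two⟧≤⟦ ℓ ⟧+⟦ m ⟧
⟦⟧-triangle two   ℓ     m     _       = ⟦two⟧≤⟦ ℓ ⟧+⟦ m ⟧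
⟦⟧-triangle three one   one   bridged = ⊥-elim (bridged refl refl refl)
⟦⟧-triangle three one   two   _       = ≤-refl
⟦⟧-triangle three one   three _       = from-yes (⟦ three ⟧ ≤? ⟦ one ⟧ + ⟦ three ⟧)
⟦⟧-triangle three two   m     _       = +-monoʳ-≤ ⟦ two ⟧ 1≤⟦ m ⟧
⟦⟧-triangle three three m     _       = ≤-trans (from-yes (⟦ three ⟧ ≤? ⟦ three ⟧ + 1ℚ)) (+-monoʳ-≤ ⟦ three ⟧ 1≤⟦ m ⟧)

-- δ need not vanish on equal labels: dist is 0 on the diagonal of Fin n regardless.
module LengthMetric {P : Set} (δ : P → P → Length) (δ-sym : ∀ r s → δ r s ≡ δ s r)
                    (δ-unbridged : ∀ r t → δ r t ≡ three → ∀ s → δ r s ≡ one → δ s t ≡ one → ⊥)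
                    {n : ℕ} (ρ : Fin n → P) where

  dist : Fin n → Fin n → ℚ
  dist x y with x ≟ y
  ... | yes _ = 0ℚ
  ... | no  _ = ⟦ δ (ρ x) (ρ y) ⟧

  dist-refl : ∀ x → dist x x ≡ 0ℚ
  dist-refl x with x ≟ x
  ... | yes _   = refl
  ... | no  x≢x = ⊥-elim (x≢x refl)

  dist-apart : ∀ {x y} → x ≢ y → dist x y ≡ ⟦ δ (ρ x) (ρ y) ⟧
  dist-apart {x} {y} x≢y with x ≟ y
  ... | yes x≡y = ⊥-elim (x≢y x≡y)
  ... | no  _   = refl

  dist-nonneg : ∀ x y → 0ℚ ≤ dist x y
  dist-nonneg x y with x ≟ y
  ... | yes _ = ≤-refl
  ... | no  _ = <⇒≤ 0<⟦ δ (ρ x) (ρ y) ⟧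

  dist≡0⇒≡ : ∀ x y → dist x y ≡ 0ℚ → x ≡ y
  dist≡0⇒≡ x y with x ≟ y
  ... | yes x≡y = λ _ → x≡y
  ... | no  _   = λ ⟦δ⟧≡0 → ⊥-elim (<-irrefl (sym ⟦δ⟧≡0) 0<⟦ δ (ρ x) (ρ y) ⟧)

  dist-sym : ∀ x y → dist x y ≡ dist y x
  dist-sym x y with x ≟ y | y ≟ x
  ... | yes _   | yes _   = refl
  ... | no  _   | no  _   = cong ⟦_⟧ (δ-sym (ρ x) (ρ y))
  ... | yes x≡y | no  y≢x = ⊥-elim (y≢x (sym x≡y))
  ... | no  x≢y | yes y≡x = ⊥-elim (x≢y (sym y≡x))

  dist-triangle : ∀ x y z → dist x z ≤ dist x y + dist y z
  dist-triangle x y z = by-cases (x ≟ y) (y ≟ z) (x ≟ z)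
    where
    by-cases : Dec (x ≡ y) → Dec (y ≡ z) → Dec (x ≡ z) → dist x z ≤ dist x y + dist y z
    by-cases (yes refl) _ _ rewrite dist-refl x = ≤-reflexive (sym (+-identityˡ (dist x z)))
    by-cases _ (yes refl) _ rewrite dist-refl y = ≤-reflexive (sym (+-identityʳ (dist x y)))
    by-cases _ _ (yes refl) rewrite dist-refl x = +-mono-≤ (dist-nonneg x y) (dist-nonneg y x)
    by-cases (no x≢y) (no y≢z) (no x≢z) rewrite dist-apart x≢y | dist-apart y≢z | dist-apart x≢z =
      ⟦⟧-triangle _ _ _ (λ far → δ-unbridged (ρ x) (ρ z) far (ρ y))

  isMetric : IsMetric dist
  isMetric = record
    { nonneg    = dist-nonneg
    ; zero⇔eq   = λ x y → dist≡0⇒≡ x y , λ { refl → dist-refl x }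
    ; symmetric = dist-sym
    ; triangle  = dist-triangle
    }

record Gadget {n : ℕ} (d : Fin n → Fin n → ℚ) (m : ℕ) : Set where
  field
    a b     : Fin n
    y z     : Fin m → Fin n
    d-y-a   : ∀ j → d (y j) a ≡ ⟦ one ⟧
    d-b-z   : ∀ j → d b (z j) ≡ ⟦ one ⟧
    d-y-z   : ∀ j → d (y j) (z j) ≡ ⟦ three ⟧
    d-y-z′  : ∀ {j l} → j ≢ l → d (y j) (z l) ≡ ⟦ two ⟧
    d-y-y   : ∀ {j l} → j ≢ l → d (y j) (y l) ≡ ⟦ two ⟧
    d-z-z   : ∀ {j l} → j ≢ l → d (z j) (z l) ≡ ⟦ two ⟧

module _ {n m : ℕ} {d : Fin n → Fin n → ℚ} (G : Gadget d m)
         {f : Fin n → ℕ → ℚ} {t : ℚ} (t*2<3 : t * ⟦ two ⟧ < ⟦ three ⟧) (distortion : HasDistortion d f t)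
         where
  open Gadget G

  ∣f-f∣≤t*d : ∀ u v i → ∣ f u i - f v i ∣ ≤ t * d u v
  ∣f-f∣≤t*d u v i = proj₁ (distortion u v) i

  ∣f-f∣<3 : ∀ {u v} → d u v ≡ ⟦ two ⟧ → ∀ i → ∣ f u i - f v i ∣ < ⟦ three ⟧
  ∣f-f∣<3 {u} {v} d≡2 i = ≤-<-trans (subst (λ e → ∣ f u i - f v i ∣ ≤ t * e) d≡2 (∣f-f∣≤t*d u v i)) t*2<3

  far-coordinate : Fin m → ℕ
  far-coordinate j = proj₁ (proj₂ (distortion (y j) (z j)))

  3≤∣f-f∣-at-far-coordinate : ∀ j → let i = far-coordinate j in ⟦ three ⟧ ≤ ∣ f (y j) i - f (z j) i ∣
  3≤∣f-f∣-at-far-coordinate j = subst (_≤ _) (d-y-z j) (proj₂ (proj₂ (distortion (y j) (z j))))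

  far-coordinate< : ∀ {K} → (∀ i → K ℕ.≤ i → f a i ≡ f b i) → ∀ j → far-coordinate j ℕ.< K
  far-coordinate< {K} a≡b-above-K j = ℕ.≰⇒> λ K≤i → <-irrefl refl (begin-strict
      ⟦ three ⟧                            ≤⟨ 3≤∣f-f∣-at-far-coordinate j ⟩
      ∣ f (y j) i - f (z j) i ∣            ≤⟨ ∣p-q∣≤∣p-r∣+∣r-q∣ (f (y j) i) (f (z j) i) (f a i) ⟩
      ∣ f (y j) i - f a i ∣ + ∣ f a i - f (z j) i ∣
        ≡⟨ cong (λ r → ∣ f (y j) i - f a i ∣ + ∣ r - f (z j) i ∣) (a≡b-above-K i K≤i) ⟩
      ∣ f (y j) i - f a i ∣ + ∣ f b i - f (z j) i ∣
        ≤⟨ +-mono-≤ (∣f-f∣≤t*d (y j) a i) (∣f-f∣≤t*d b (z j) i) ⟩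
      t * d (y j) a + t * d b (z j)        ≡⟨ cong₂ (λ r s → t * r + t * s) (d-y-a j) (d-b-z j) ⟩
      t * ⟦ one ⟧ + t * ⟦ one ⟧            ≡⟨ *-distribˡ-+ t ⟦ one ⟧ ⟦ one ⟧ ⟨
      t * ⟦ two ⟧                          <⟨ t*2<3 ⟩
      ⟦ three ⟧                            ∎)
    where
    open ≤-Reasoning
    i : ℕ
    i = far-coordinate j

  gadget-size≤ : ∀ {K} → (∀ i → K ℕ.≤ i → f a i ≡ f b i) → m ℕ.≤ K
  gadget-size≤ {K} a≡b-above-K = ℕ.≮⇒≥ λ K<m → collision (pigeonhole K<m coordinate)
    where
    coordinate : Fin m → Fin K
    coordinate j = fromℕ< (far-coordinate< a≡b-above-K j)

    collision : (∃₂ λ j l → j Fin.< l × coordinate j ≡ coordinate l) → ⊥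
    collision (j , l , j<l , same) =
      far-pairs-not-crosswise-close (f (y j) i) (f (z j) i) (f (y l) i) (f (z l) i)
        (3≤∣f-f∣-at-far-coordinate j) far-l
        (∣f-f∣<3 (d-y-z′ j≢l) i) (∣f-f∣<3 (d-y-z′ (j≢l ∘ sym)) i)
        (∣f-f∣<3 (d-y-y j≢l) i)  (∣f-f∣<3 (d-z-z j≢l) i)
      where
      i : ℕ
      i = far-coordinate j
      j≢l : j ≢ l
      j≢l = <⇒≢ j<l
      same-coordinate : far-coordinate l ≡ i
      same-coordinate = trans (sym (toℕ-fromℕ< _)) (trans (cong toℕ (sym same)) (toℕ-fromℕ< _))
      far-l : ⟦ three ⟧ ≤ ∣ f (y l) i - f (z l) i ∣
      far-l = subst (λ k → ⟦ three ⟧ ≤ ∣ f (y l) k - f (z l) k ∣) same-coordinate (3≤∣f-f∣-at-far-coordinate l)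

gap : ∀ {m} → Fin m → Fin m → Length
gap j l with j ≟ l
... | yes _ = three
... | no  _ = two

gap≢one : ∀ {m} (j l : Fin m) → gap j l ≢ one
gap≢one j l with j ≟ l
... | yes _ = λ ()
... | no  _ = λ ()

gap-apart : ∀ {m} {j l : Fin m} → j ≢ l → gap j l ≡ two
gap-apart {j = j} {l} j≢l with j ≟ l
... | yes j≡l = ⊥-elim (j≢l j≡l)
... | no  _   = refl

gap-refl : ∀ {m} (j : Fin m) → gap j j ≡ three
gap-refl j with j ≟ j
... | yes _   = refl
... | no  j≢j = ⊥-elim (j≢j refl)

module GadgetSpace (m : ℕ) where
  data Point : Set where
    a b : Point
    y z : Fin m → Point

  δ : Point → Point → Length
  δ a     b     = one
  δ b     a     = one
  δ a     (y _) = one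
  δ (y _) a     = one
  δ b     (z _) = one
  δ (z _) b     = one
  δ (y j) (z l) = gap j l
  δ (z j) (y l) = gap l j
  δ _     _     = two

  δ-sym : ∀ r s → δ r s ≡ δ s r
  δ-sym a     = λ { a → refl ; b → refl ; (y _) → refl ; (z _) → refl }
  δ-sym b     = λ { a → refl ; b → refl ; (y _) → refl ; (z _) → refl }
  δ-sym (y _) = λ { a → refl ; b → refl ; (y _) → refl ; (z _) → refl }
  δ-sym (z _) = λ { a → refl ; b → refl ; (y _) → refl ; (z _) → refl }

  y-z-unbridged : ∀ j l s → δ (y j) s ≡ one → δ s (z l) ≡ one → ⊥
  y-z-unbridged j l a     _   ()
  y-z-unbridged j l b     ()
  y-z-unbridged j l (y _) ()
  y-z-unbridged j l (z k) j~k _ = gap≢one j k j~k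

  δ-unbridged : ∀ r t → δ r t ≡ three → ∀ s → δ r s ≡ one → δ s t ≡ one → ⊥
  δ-unbridged a     = λ { a () ; b () ; (y _) () ; (z _) () }
  δ-unbridged b     = λ { a () ; b () ; (y _) () ; (z _) () }
  δ-unbridged (y j) = λ { a () ; b () ; (y _) () ; (z l) _ → y-z-unbridged j l }
  δ-unbridged (z j) = λ { a () ; b () ; (z _) ()
                        ; (y l) _ s z~s s~y → y-z-unbridged l j s (trans (δ-sym (y l) s) s~y) (trans (δ-sym s (z j)) z~s) }

  -- a and b come first in the priority ordering.
  ρ : Fin (2 ℕ.+ (m ℕ.+ m)) → Point
  ρ zero          = a
  ρ (suc zero)    = b
  ρ (suc (suc k)) = [ y , z ]′ (splitAt m k)

  ι : Point → Fin (2 ℕ.+ (m ℕ.+ m))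
  ι a     = zero
  ι b     = suc zero
  ι (y j) = suc (suc (j ↑ˡ m))
  ι (z j) = suc (suc (m ↑ʳ j))

  ρ∘ι : ∀ r → ρ (ι r) ≡ r
  ρ∘ι a     = refl
  ρ∘ι b     = refl
  ρ∘ι (y j) = cong [ y , z ]′ (splitAt-↑ˡ m j m)
  ρ∘ι (z j) = cong [ y , z ]′ (splitAt-↑ʳ m m j)

  open LengthMetric δ δ-sym δ-unbridged ρ public

  dist-ι : ∀ r s → r ≢ s → dist (ι r) (ι s) ≡ ⟦ δ r s ⟧
  dist-ι r s r≢s =
    trans (dist-apart {ι r} {ι s} (λ ιr≡ιs → r≢s (trans (sym (ρ∘ι r)) (trans (cong ρ ιr≡ιs) (ρ∘ι s)))))
          (cong₂ (λ r′ s′ → ⟦ δ r′ s′ ⟧) (ρ∘ι r) (ρ∘ι s))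

  gadget : Gadget dist m
  gadget = record
    { a      = ι a
    ; b      = ι b
    ; y      = ι ∘ y
    ; z      = ι ∘ z
    ; d-y-a  = λ j → dist-ι (y j) a λ ()
    ; d-b-z  = λ j → dist-ι b (z j) λ ()
    ; d-y-z  = λ j → trans (dist-ι (y j) (z j) λ ()) (cong ⟦_⟧ (gap-refl j))
    ; d-y-z′ = λ {j} {l} j≢l → trans (dist-ι (y j) (z l) λ ()) (cong ⟦_⟧ (gap-apart j≢l))
    ; d-y-y  = λ {j} {l} j≢l → dist-ι (y j) (y l) λ { refl → j≢l refl }
    ; d-z-z  = λ {j} {l} j≢l → dist-ι (z j) (z l) λ { refl → j≢l refl }
    }

theorem2p2 : (t : ℚ) → 1ℚ ≤ t → t < three-halves →
    ¬ (Σ (ℕ → ℕ) λ α →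
         (n : ℕ) (d : Fin n → Fin n → ℚ) → IsMetric d →
         Σ (Fin n → ℕ → ℚ) λ f → HasDistortion d f t × PrioritizedDim α f)
theorem2p2 t _ t<3/2 (α , embed) = no-embedding (embed _ dist isMetric)
  where
  K : ℕ
  K = α 1 ℕ.⊔ α 2

  open GadgetSpace (ℕ.suc K)

  t*2<3 : t * ⟦ two ⟧ < ⟦ three ⟧
  t*2<3 = *-monoˡ-<-pos ⟦ two ⟧ t<3/2

  no-embedding : ¬ (Σ (Fin _ → ℕ → ℚ) λ f → HasDistortion dist f t × PrioritizedDim α f)
  no-embedding (f , distortion , prioritized) = ℕ.n≮n K (gadget-size≤ gadget {f} {t} t*2<3 distortion a≡b-above-K)
    where
    a≡b-above-K : ∀ i → K ℕ.≤ i → f (ι a) i ≡ f (ι b) i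
    a≡b-above-K i K≤i = trans (prioritized (ι a) i (ℕ.s≤s (ℕ.≤-trans (ℕ.m≤m⊔n (α 1) (α 2)) K≤i)))
                              (sym (prioritized (ι b) i (ℕ.s≤s (ℕ.≤-trans (ℕ.m≤n⊔m (α 1) (α 2)) K≤i))))
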